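{- Let $G$ be a map on an orientable surface, $D_0$ an orientation of $G$ and $f_0$ a face of $G$. For every $\widetilde F\in\widetilde{\mathcal{F}}$ there exists $D\in O(G,D_0)$ such that $\widetilde F$ is an oriented subgraph of $D$.
   Context: A map is a graph embedded on an orientable surface with all faces homeomorphic to open disks (contractible cycles of length 1 or 2 allowed). Fix a reference orientation of edges; walks and oriented subgraphs (sets of edges each with a direction) have characteristic flows in $\mathbb{Z}^E$. $\mathbb{F}$ is the subgroup generated by characteristic flows of counterclockwise facial walks; $T$ is $0$-homologous if $\phi(T)\in\mathbb{F}$. For orientations $D,D'$, $D\setminus D'$ is the oriented subgraph of $D$ formed by edges oriented differently in $D'$. $O(G,D_0)$ is the set of orientations $D$ with $D\setminus D_0$ $0$-homologous. An edge is rigid if it has the same orientation in all elements of $O(G,D_0)$; $\widetilde G$ is obtained from $G$ by deleting rigid edges; $\widetilde{\mathcal{F}}$ is the set of oriented subgraphs formed by the boundaries of faces of $\widetilde G$ oriented counterclockwise. An oriented subgraph $S$ is an oriented subgraph of $D$ if each edge of $S$ is oriented in $D$ as in $S$. -}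

module Defs where

open import Data.Nat as ℕ using (ℕ; zero; suc)
open import Data.Fin as Fin using (Fin)
open import Data.Bool using (Bool; true; false; not; if_then_else_; _xor_)
open import Data.Bool.Properties as BoolP using ()
open import Data.Maybe using (Maybe; just; nothing)
open import Data.Integer as ℤ using (ℤ; +_)
open import Data.List using (List; upTo)
open import Data.Bool.ListAction using (any)
open import Data.Product using (Σ; Σ-syntax; _×_; _,_; proj₁)
open import Data.Product.Properties using (≡-dec)
open import Data.Sum using (_⊎_)
open import Relation.Nullary using (¬_)
open import Relation.Nullary.Decidable using (⌊_⌋)
open import Relation.Binary.PropositionalEquality using (_≡_)
open import Relation.Binary.Construct.Closure.ReflexiveTransitive using (Star)
open import Relation.Binary.Construct.Closure.Equivalence using (EqClosure)
open import Function.Bundles using (_↔_; Inverse)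

-- Edges are Fin m; each edge e carries a fixed reference orientation.
-- A dart (e , true) is edge e traversed along its reference orientation,
-- (e , false) is e traversed against it.  A map is given by a permutation σ of the darts sending each
-- dart to the next dart, in CLOCKWISE order, around its origin vertex
-- (vertices = orbits of σ).  Loops and multiple edges are allowed.
-- A connected rotation system is exactly a (cellularly embedded) map on
-- an orientable surface.  Faces are the orbits of φ = σ ∘ α; with the
-- clockwise convention for σ these orbits are the COUNTERCLOCKWISE facial
-- walks (the face lies to the left of each of its darts).

Dart : ℕ → Set
Dart m = Fin m × Bool

α : ∀ {m} → Dart m → Dart m
α (e , b) = e , not b

record Map (m : ℕ) : Set where
  field
    σ : Dart m ↔ Dart m
    connected : ∀ d d' →
      Star (λ x y → (Inverse.to σ x ≡ y) ⊎ (α x ≡ y)) d d'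

  rot : Dart m → Dart m
  rot = Inverse.to σ

  φ : Dart m → Dart m
  φ d = rot (α d)

open Map public

iter : ∀ {A : Set} → (A → A) → ℕ → A → A
iter f zero    x = x
iter f (suc k) x = f (iter f k x)

_≟D_ : ∀ {m} (x y : Dart m) → Relation.Nullary.Dec (x ≡ y)
_≟D_ = ≡-dec Fin._≟_ BoolP._≟_

-- x lies on the counterclockwise facial walk through d
-- (an orbit of φ has length at most the number 2m of darts)
onFace : ∀ {m} → Map m → Dart m → Dart m → Bool
onFace {m} M d x = any (λ k → ⌊ iter (φ M) k d ≟D x ⌋) (upTo (2 ℕ.* m))

Flow : ℕ → Set
Flow m = Fin m → ℤ

ind : Bool → ℤ
ind true  = + 1
ind false = + 0

-- characteristic flow of the counterclockwise facial walk through d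
-- (a facial walk traverses each dart at most once)
faceFlow : ∀ {m} → Map m → Dart m → Flow m
faceFlow M d e = ind (onFace M d (e , true)) ℤ.- ind (onFace M d (e , false))

sumFin : ∀ {n} → (Fin n → ℤ) → ℤ
sumFin {zero}  f = + 0
sumFin {suc n} f = f Fin.zero ℤ.+ sumFin (λ i → f (Fin.suc i))

sumDart : ∀ {m} → (Dart m → ℤ) → ℤ
sumDart f = sumFin (λ e → f (e , true) ℤ.+ f (e , false))

-- 𝔽 : subgroup of ℤ^E generated by the facial flows
-- (integer combinations; every face is represented by each of its darts)
InF : ∀ {m} → Map m → Flow m → Set
InF M ψ = Σ[ c ∈ (Dart _ → ℤ) ] (∀ e → ψ e ≡ sumDart (λ d → c d ℤ.* faceFlow M d e))

Orientation : ℕ → Set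
Orientation m = Fin m → Bool        -- true = reference orientation

OrSub : ℕ → Set
OrSub m = Fin m → Maybe Bool        -- nothing = edge absent

flowOf : ∀ {m} → OrSub m → Flow m
flowOf T e with T e
... | nothing    = + 0
... | just true  = + 1
... | just false = ℤ.- (+ 1)

ZeroHomologous : ∀ {m} → Map m → OrSub m → Set
ZeroHomologous M T = InF M (flowOf T)

_∖_ : ∀ {m} → Orientation m → Orientation m → OrSub m
(D ∖ D') e = if D e xor D' e then just (D e) else nothing

InO : ∀ {m} → Map m → Orientation m → Orientation m → Set
InO M D₀ D = ZeroHomologous M (D ∖ D₀)

Rigid : ∀ {m} → Map m → Orientation m → Fin m → Set
Rigid M D₀ e = ∀ D D' → InO M D₀ D → InO M D₀ D' → D e ≡ D' e

-- Faces of G̃ (G minus rigid edges): two darts lie on the same face of G̃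
-- iff one passes from one to the other by moving along faces of G and
-- crossing rigid (deleted) edges.
Step : ∀ {m} → Map m → Orientation m → Dart m → Dart m → Set
Step M D₀ d d' = (φ M d ≡ d') ⊎ (Rigid M D₀ (proj₁ d) × α d ≡ d')

SameFaceG̃ : ∀ {m} → Map m → Orientation m → Dart m → Dart m → Set
SameFaceG̃ M D₀ = EqClosure (Step M D₀)

-- S ∈ 𝓕̃ : S is the counterclockwise boundary of the face of G̃ containing
-- (the face of G to the left of) the dart d₀: an edge e of G̃ belongs to S
-- with direction b iff the dart (e , b) has this face to its left (and the
-- opposite dart does not).
InFtilde : ∀ {m} → Map m → Orientation m → OrSub m → Set
InFtilde {m} M D₀ S = Σ[ d₀ ∈ Dart m ] (∀ e b →
  (S e ≡ just b →
     (¬ Rigid M D₀ e) × SameFaceG̃ M D₀ d₀ (e , b) × ¬ SameFaceG̃ M D₀ d₀ (e , not b))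
  × ((¬ Rigid M D₀ e) × SameFaceG̃ M D₀ d₀ (e , b) × ¬ SameFaceG̃ M D₀ d₀ (e , not b) →
     S e ≡ just b))

SubOf : ∀ {m} → OrSub m → Orientation m → Set
SubOf S D = ∀ e b → S e ≡ just b → D e ≡ b

module Submission where

-- A flow lies in 𝔽 iff it is the coboundary δH of a face potential H
-- (an integer labeling of the darts constant on faces), so D ∈ O(G, D₀)
-- iff D ∖ D₀ has such a potential; dart by dart, H drops by
-- [x against D₀] − [x against D] from x to the reverse dart α x.
-- Potentials are constant on faces of G̃ (crossing a rigid edge costs
-- nothing).  Fix the dart d₀ whose G̃-face is F̃, and let dist be the
-- shortest-path distance from d₀ with arcs x → φ x of length 0 and
-- x → α x of length [x against D₀], computed by Bellman–Ford relaxation.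
-- Then −dist is the potential of an orientation D* ∈ O(G, D₀), and
-- H d₀ − H ≤ dist for the potential H of any D ∈ O(G, D₀).  If an edge
-- of F̃ disagreed with D*, these inequalities would pin down its
-- orientation in every D ∈ O(G, D₀), making it rigid; so F̃ ⊆ D*.

open import Defs
open import Data.Nat using (ℕ)
open import Data.Product using (Σ-syntax; _×_)

open import Data.Nat as ℕ using (zero; suc; _+_; _*_; _∸_; _≤_; _<_; _<?_; z≤n)
import Data.Nat.Properties as ℕP
open import Data.Nat.DivMod using (_%_; _/_; m≡m%n+[m/n]*n; m%n<n)
open import Data.Fin as Fin using (Fin; toℕ)
import Data.Fin.Properties as FinP
open import Data.Bool using (Bool; true; false; not; _xor_; if_then_else_)
import Data.Bool.Properties as BoolP
open import Data.Integer as ℤ using (ℤ; +_)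
import Data.Integer.Properties as ℤP
open import Data.Integer.Tactic.RingSolver using (solve-∀)
open import Data.Product using (Σ; _,_; proj₁; proj₂)
open import Data.Sum using (_⊎_; inj₁; inj₂; [_,_])
open import Data.Unit using (⊤; tt)
open import Data.Empty using (⊥-elim)
open import Data.List using (List; applyUpTo; upTo)
import Data.List.Relation.Unary.Any.Properties as AnyP
import Data.List.Relation.Unary.All.Properties as AllP
import Data.List.Extrema.Nat as Extrema
open import Function using (_∘_; _⇔_; mk⇔; Inverse; Injection; Equivalence)
open import Function.Properties.Inverse using (↔⇒↣)
open import Function.Construct.Symmetry using (↔-sym)
open import Relation.Nullary using (Dec; yes; no)
open import Relation.Nullary.Decidable using (⌊_⌋; toWitness; fromWitness; map′; _⊎-dec_)
open import Relation.Binary.Construct.Closure.ReflexiveTransitive using (Star; ε; _◅_)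
open import Relation.Binary.Construct.Closure.Symmetric using (fwd; bwd)
open import Relation.Binary.PropositionalEquality using (_≡_; _≢_; refl; sym; trans; cong; cong₂; subst; module ≡-Reasoning)

iter-+ : ∀ {A : Set} (f : A → A) k j x → iter f (k + j) x ≡ iter f k (iter f j x)
iter-+ f zero    j x = refl
iter-+ f (suc k) j x = cong f (iter-+ f k j x)

module Orbits {A : Set} {n : ℕ}
  (code : A → Fin n) (code-inj : ∀ {x y} → code x ≡ code y → x ≡ y)
  (f : A → A) (f-inj : ∀ {x y} → f x ≡ f y → x ≡ y) where

  iter-inj : ∀ k {x y} → iter f k x ≡ iter f k y → x ≡ y
  iter-inj zero    eq = eq
  iter-inj (suc k) eq = iter-inj k (f-inj eq)

  -- Pigeonhole on x, f x, …, fⁿ x: some fⁱ x = fʲ x with i < j ≤ n,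
  -- and injectivity turns this into f^(j∸i) x = x.
  period : ∀ x → Σ ℕ λ p → 0 < p × p ≤ n × iter f p x ≡ x
  period x with FinP.pigeonhole ℕP.≤-refl (λ (i : Fin (suc n)) → code (iter f (toℕ i) x))
  ... | i , j , i<j , eq = toℕ j ∸ toℕ i , ℕP.m<n⇒0<n∸m i<j , p≤n , sym (iter-inj (toℕ i) shift)
    where
    p≤n : toℕ j ∸ toℕ i ≤ n
    p≤n = ℕP.≤-trans (ℕP.m∸n≤m (toℕ j) (toℕ i)) (ℕP.≤-pred (FinP.toℕ<n j))
    shift : iter f (toℕ i) x ≡ iter f (toℕ i) (iter f (toℕ j ∸ toℕ i) x)
    shift = begin
      iter f (toℕ i) x                              ≡⟨ code-inj eq ⟩
      iter f (toℕ j) x                              ≡⟨ cong (λ k → iter f k x) (sym (ℕP.m∸n+n≡m (ℕP.<⇒≤ i<j))) ⟩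
      iter f (toℕ j ∸ toℕ i + toℕ i) x              ≡⟨ cong (λ k → iter f k x) (ℕP.+-comm (toℕ j ∸ toℕ i) (toℕ i)) ⟩
      iter f (toℕ i + (toℕ j ∸ toℕ i)) x            ≡⟨ iter-+ f (toℕ i) (toℕ j ∸ toℕ i) x ⟩
      iter f (toℕ i) (iter f (toℕ j ∸ toℕ i) x)     ∎
      where open ≡-Reasoning

  iter-periodic : ∀ {p x} → iter f p x ≡ x → ∀ q → iter f (q * p) x ≡ x
  iter-periodic fix zero = refl
  iter-periodic {p} {x} fix (suc q) =
    trans (iter-+ f p (q * p) x) (trans (cong (iter f p) (iter-periodic fix q)) fix)

  Reach : A → A → Set
  Reach x y = Σ ℕ λ k → iter f k x ≡ y

  reach-refl : ∀ {x} → Reach x x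
  reach-refl = zero , refl

  reach-step : ∀ x → Reach x (f x)
  reach-step x = 1 , refl

  reach-trans : ∀ {x y z} → Reach x y → Reach y z → Reach x z
  reach-trans {x} (k , refl) (l , refl) = l + k , iter-+ f l k x

  -- With p the period of x, f^(k·p) x = x, so k·p − k further steps lead
  -- from f^k x back to x.
  reach-sym : ∀ {x y} → Reach x y → Reach y x
  reach-sym {x} (k , refl) with period x
  ... | suc p , _ , _ , fix = k * suc p ∸ k , (begin
      iter f (k * suc p ∸ k) (iter f k x)   ≡⟨ sym (iter-+ f (k * suc p ∸ k) k x) ⟩
      iter f (k * suc p ∸ k + k) x          ≡⟨ cong (λ l → iter f l x) (ℕP.m∸n+n≡m (ℕP.m≤m*n k (suc p))) ⟩
      iter f (k * suc p) x                  ≡⟨ iter-periodic fix k ⟩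
      x                                     ∎)
    where open ≡-Reasoning

  -- Every point of the orbit of x is reached in fewer than n steps
  -- (reduce the number of steps modulo the period).
  reach-bounded : ∀ {x y} → Reach x y → Σ ℕ λ j → j < n × iter f j x ≡ y
  reach-bounded {x} (k , refl) with period x
  ... | suc p , _ , p≤n , fix = k % suc p , ℕP.<-≤-trans (m%n<n k (suc p)) p≤n , (begin
      iter f (k % suc p) x                              ≡⟨ cong (iter f (k % suc p)) (sym (iter-periodic fix (k / suc p))) ⟩
      iter f (k % suc p) (iter f (k / suc p * suc p) x) ≡⟨ sym (iter-+ f (k % suc p) (k / suc p * suc p) x) ⟩
      iter f (k % suc p + k / suc p * suc p) x          ≡⟨ cong (λ l → iter f l x) (sym (m≡m%n+[m/n]*n k (suc p))) ⟩
      iter f k x                                        ∎)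
    where open ≡-Reasoning

  non-increasing⇒constant : (d : A → ℕ) → (∀ x → d (f x) ≤ d x) → ∀ {x y} → Reach x y → d x ≡ d y
  non-increasing⇒constant d d-f≤d r = ℕP.≤-antisym (along (reach-sym r)) (along r)
    where
    along : ∀ {x y} → Reach x y → d y ≤ d x
    along (zero  , refl) = ℕP.≤-refl
    along (suc k , refl) = ℕP.≤-trans (d-f≤d _) (along (k , refl))

  orbit : A → List A
  orbit x = applyUpTo (λ k → iter f k x) n

  rep : A → A
  rep x = Extrema.argmin (toℕ ∘ code) x (orbit x)

  rep-reach : ∀ x → Reach x (rep x)
  rep-reach x = Extrema.argmin-all (toℕ ∘ code) {P = Reach x} reach-refl
    (AllP.applyUpTo⁺₁ (λ k → iter f k x) n (λ {k} _ → k , refl))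

  rep-least : ∀ {x y} → Reach x y → toℕ (code (rep x)) ≤ toℕ (code y)
  rep-least {x} r with reach-bounded r
  ... | j , j<n , refl = Extrema.f[argmin]≤v⁺ {f = toℕ ∘ code} x (orbit x)
    (inj₂ (AnyP.applyUpTo⁺ (λ k → iter f k x) ℕP.≤-refl j<n))

  rep-canonical : ∀ {x y} → Reach x y → rep x ≡ rep y
  rep-canonical {x} {y} r = code-inj (FinP.toℕ-injective (ℕP.≤-antisym
    (rep-least (reach-trans r (rep-reach y)))
    (rep-least (reach-trans (reach-sym r) (rep-reach x)))))

dartCode : ∀ {m} → Dart m → Fin (m * 2)
dartCode (e , b) = Fin.combine e (Inverse.from FinP.2↔Bool b)

dartCode-inj : ∀ {m} {x y : Dart m} → dartCode x ≡ dartCode y → x ≡ y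
dartCode-inj {x = e , b} {e' , b'} eq with FinP.combine-injective e _ e' _ eq
... | refl , q = cong (e ,_) (Injection.injective (↔⇒↣ (↔-sym FinP.2↔Bool)) q)

α-involutive : ∀ {m} (x : Dart m) → α (α x) ≡ x
α-involutive (e , b) = cong (e ,_) (BoolP.not-involutive b)

module Faces {m : ℕ} (M : Map m) where

  φ-inj : ∀ {x y} → φ M x ≡ φ M y → x ≡ y
  φ-inj {x} {y} eq = begin
    x         ≡⟨ sym (α-involutive x) ⟩
    α (α x)   ≡⟨ cong α (Injection.injective (↔⇒↣ (σ M)) eq) ⟩
    α (α y)   ≡⟨ α-involutive y ⟩
    y         ∎
    where open ≡-Reasoning

  open Orbits dartCode dartCode-inj (φ M) φ-inj public

  onFace⇔Reach : ∀ {d x} → onFace M d x ≡ true ⇔ Reach d x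
  onFace⇔Reach {d} {x} = mk⇔ sound complete
    where
    test : ℕ → Bool
    test k = ⌊ iter (φ M) k d ≟D x ⌋

    sound : onFace M d x ≡ true → Reach d x
    sound h with AnyP.applyUpTo⁻ (λ k → k) {2 * m} (AnyP.any⁻ test (upTo (2 * m)) (Equivalence.from BoolP.T-≡ h))
    ... | k , _ , t = k , toWitness t

    complete : Reach d x → onFace M d x ≡ true
    complete r with reach-bounded r
    ... | j , j<n , eq = Equivalence.to BoolP.T-≡ (AnyP.any⁺ test
      (AnyP.applyUpTo⁺ (λ k → k) (fromWitness eq) (subst (j <_) (ℕP.*-comm m 2) j<n)))

  onFace-resp : ∀ d {x y} → Reach x y → onFace M d x ≡ onFace M d y
  onFace-resp d r = BoolP.⇔→≡ (mk⇔
    (λ h → Equivalence.from onFace⇔Reach (reach-trans (Equivalence.to onFace⇔Reach h) r))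
    (λ h → Equivalence.from onFace⇔Reach (reach-trans (Equivalence.to onFace⇔Reach h) (reach-sym r))))

-‿+-interchange : ∀ (a b c d : ℤ) → (a ℤ.- b) ℤ.+ (c ℤ.- d) ≡ (a ℤ.+ c) ℤ.- (b ℤ.+ d)
-‿+-interchange = solve-∀

*-distribˡ-‿- : ∀ (c a b : ℤ) → c ℤ.* (a ℤ.- b) ≡ c ℤ.* a ℤ.- c ℤ.* b
*-distribˡ-‿- = solve-∀

sumFin-cong : ∀ {n} {f g : Fin n → ℤ} → (∀ i → f i ≡ g i) → sumFin f ≡ sumFin g
sumFin-cong {zero}  eq = refl
sumFin-cong {suc n} eq = cong₂ ℤ._+_ (eq Fin.zero) (sumFin-cong (eq ∘ Fin.suc))

sumFin-sub : ∀ {n} (f g : Fin n → ℤ) → sumFin (λ i → f i ℤ.- g i) ≡ sumFin f ℤ.- sumFin g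
sumFin-sub {zero}  f g = refl
sumFin-sub {suc n} f g = trans (cong (λ s → (f Fin.zero ℤ.- g Fin.zero) ℤ.+ s) (sumFin-sub (f ∘ Fin.suc) (g ∘ Fin.suc)))
  (-‿+-interchange (f Fin.zero) (g Fin.zero) (sumFin (f ∘ Fin.suc)) (sumFin (g ∘ Fin.suc)))

sumFin-zero : ∀ {n} (f : Fin n → ℤ) → (∀ i → f i ≡ + 0) → sumFin f ≡ + 0
sumFin-zero {zero}  f z = refl
sumFin-zero {suc n} f z = cong₂ ℤ._+_ (z Fin.zero) (sumFin-zero (f ∘ Fin.suc) (z ∘ Fin.suc))

sumFin-single : ∀ {n} (f : Fin n → ℤ) k → (∀ i → i ≢ k → f i ≡ + 0) → sumFin f ≡ f k
sumFin-single {suc n} f Fin.zero z = begin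
  f Fin.zero ℤ.+ sumFin (f ∘ Fin.suc) ≡⟨ cong (λ s → f Fin.zero ℤ.+ s) (sumFin-zero (f ∘ Fin.suc) (λ i → z (Fin.suc i) λ ())) ⟩
  f Fin.zero ℤ.+ + 0                  ≡⟨ ℤP.+-identityʳ (f Fin.zero) ⟩
  f Fin.zero                          ∎
  where open ≡-Reasoning
sumFin-single {suc n} f (Fin.suc k) z = begin
  f Fin.zero ℤ.+ sumFin (f ∘ Fin.suc) ≡⟨ cong₂ ℤ._+_ (z Fin.zero λ ()) (sumFin-single (f ∘ Fin.suc) k (λ i i≢k → z (Fin.suc i) (i≢k ∘ FinP.suc-injective))) ⟩
  + 0 ℤ.+ f (Fin.suc k)               ≡⟨ ℤP.+-identityˡ (f (Fin.suc k)) ⟩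
  f (Fin.suc k)                       ∎
  where open ≡-Reasoning

sumDart-cong : ∀ {m} {f g : Dart m → ℤ} → (∀ x → f x ≡ g x) → sumDart f ≡ sumDart g
sumDart-cong eq = sumFin-cong (λ e → cong₂ ℤ._+_ (eq (e , true)) (eq (e , false)))

sumDart-sub : ∀ {m} (f g : Dart m → ℤ) → sumDart (λ x → f x ℤ.- g x) ≡ sumDart f ℤ.- sumDart g
sumDart-sub f g = trans
  (sumFin-cong (λ e → -‿+-interchange (f (e , true)) (g (e , true)) (f (e , false)) (g (e , false))))
  (sumFin-sub (λ e → f (e , true) ℤ.+ f (e , false)) (λ e → g (e , true) ℤ.+ g (e , false)))

sumDart-single : ∀ {m} (f : Dart m → ℤ) r → (∀ x → x ≢ r → f x ≡ + 0) → sumDart f ≡ f r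
sumDart-single f (e , b) z = trans (sumFin-single _ e off-edge) (on-edge b z)
  where
  off-edge : ∀ i → i ≢ e → f (i , true) ℤ.+ f (i , false) ≡ + 0
  off-edge i i≢e = cong₂ ℤ._+_ (z (i , true) (i≢e ∘ cong proj₁)) (z (i , false) (i≢e ∘ cong proj₁))
  on-edge : ∀ b → (∀ x → x ≢ (e , b) → f x ≡ + 0) → f (e , true) ℤ.+ f (e , false) ≡ f (e , b)
  on-edge true  z′ = trans (cong (λ s → f (e , true) ℤ.+ s) (z′ (e , false) λ ())) (ℤP.+-identityʳ _)
  on-edge false z′ = trans (cong (λ s → s ℤ.+ f (e , false)) (z′ (e , true) λ ())) (ℤP.+-identityˡ _)

-- 𝔽 consists exactly of the coboundaries of face potentials: integer
-- labelings of the darts that are constant on every face.  A combination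
-- Σ c_d (facial flow of d) is the coboundary of the potential x ↦ Σ c_d
-- [x on the face of d]; conversely a face potential is realised by putting
-- its value on the representative dart of each face.
module FacePotentials {m : ℕ} (M : Map m) where

  open Faces M

  FacePotential : (Dart m → ℤ) → Set
  FacePotential H = ∀ {x y} → Reach x y → H x ≡ H y

  δ : (Dart m → ℤ) → Flow m
  δ H e = H (e , true) ℤ.- H (e , false)

  potentialOf : (Dart m → ℤ) → Dart m → ℤ
  potentialOf c x = sumDart (λ d → c d ℤ.* ind (onFace M d x))

  potentialOf-face : ∀ c → FacePotential (potentialOf c)
  potentialOf-face c r = sumDart-cong (λ d → cong (λ b → c d ℤ.* ind b) (onFace-resp d r))

  combination≡δ : ∀ c e → sumDart (λ d → c d ℤ.* faceFlow M d e) ≡ δ (potentialOf c) e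
  combination≡δ c e = begin
    sumDart (λ d → c d ℤ.* (ind (on d true) ℤ.- ind (on d false)))
      ≡⟨ sumDart-cong (λ d → *-distribˡ-‿- (c d) (ind (on d true)) (ind (on d false))) ⟩
    sumDart (λ d → c d ℤ.* ind (on d true) ℤ.- c d ℤ.* ind (on d false))
      ≡⟨ sumDart-sub (λ d → c d ℤ.* ind (on d true)) (λ d → c d ℤ.* ind (on d false)) ⟩
    δ (potentialOf c) e ∎
    where
    open ≡-Reasoning
    on : Dart m → Bool → Bool
    on d b = onFace M d (e , b)

  onRepresentatives : (Dart m → ℤ) → Dart m → ℤ
  onRepresentatives H d = if ⌊ rep d ≟D d ⌋ then H d else + 0

  potentialOf-onRepresentatives : ∀ H → FacePotential H → ∀ x → potentialOf (onRepresentatives H) x ≡ H x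
  potentialOf-onRepresentatives H face x = trans (sumDart-single _ (rep x) elsewhere) at-rep
    where
    -- a representative dart whose face contains x is the representative of x
    elsewhere : ∀ d → d ≢ rep x → onRepresentatives H d ℤ.* ind (onFace M d x) ≡ + 0
    elsewhere d d≢r with rep d ≟D d | onFace M d x in on
    ... | no _     | _     = refl
    ... | yes _    | false = ℤP.*-zeroʳ (H d)
    ... | yes d≡rd | true  = ⊥-elim (d≢r (trans (sym d≡rd) (rep-canonical (Equivalence.to onFace⇔Reach on))))
    at-rep : onRepresentatives H (rep x) ℤ.* ind (onFace M (rep x) x) ≡ H x
    at-rep with rep (rep x) ≟D rep x
    ... | no ¬fixed = ⊥-elim (¬fixed (sym (rep-canonical (rep-reach x))))
    ... | yes _ rewrite Equivalence.from onFace⇔Reach (reach-sym (rep-reach x)) =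
      trans (ℤP.*-identityʳ (H (rep x))) (sym (face (rep-reach x)))

  InF⇒potential : ∀ {ψ} → InF M ψ → Σ (Dart m → ℤ) λ H → FacePotential H × (∀ e → ψ e ≡ δ H e)
  InF⇒potential (c , ψ≡) = potentialOf c , potentialOf-face c , λ e → trans (ψ≡ e) (combination≡δ c e)

  potential⇒InF : ∀ {ψ} H → FacePotential H → (∀ e → ψ e ≡ δ H e) → InF M ψ
  potential⇒InF H face ψ≡ = onRepresentatives H , λ e → trans (ψ≡ e) (sym (begin
    sumDart (λ d → onRepresentatives H d ℤ.* faceFlow M d e) ≡⟨ combination≡δ (onRepresentatives H) e ⟩
    δ (potentialOf (onRepresentatives H)) e                  ≡⟨ cong₂ ℤ._-_ (realised (e , true)) (realised (e , false)) ⟩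
    δ H e                                                    ∎))
    where
    open ≡-Reasoning
    realised : ∀ x → potentialOf (onRepresentatives H) x ≡ H x
    realised = potentialOf-onRepresentatives H face

∃Bool? : {P : Bool → Set} → (∀ b → Dec (P b)) → Dec (Σ Bool P)
∃Bool? P? = map′ [ (true ,_) , (false ,_) ] (λ { (true , p) → inj₁ p ; (false , p) → inj₂ p })
  (P? true ⊎-dec P? false)

∃Dart? : ∀ {m} {P : Dart m → Set} → (∀ x → Dec (P x)) → Dec (Σ (Dart m) P)
∃Dart? P? = map′ (λ (e , b , p) → (e , b) , p) (λ ((e , b) , p) → e , b , p)
  (FinP.any? (λ e → ∃Bool? (λ b → P? (e , b))))

sumℕ : ∀ {n} → (Fin n → ℕ) → ℕ
sumℕ {zero}  f = 0
sumℕ {suc n} f = f Fin.zero + sumℕ (f ∘ Fin.suc)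

sumℕ-mono : ∀ {n} {f g : Fin n → ℕ} → (∀ i → f i ≤ g i) → sumℕ f ≤ sumℕ g
sumℕ-mono {zero}  f≤g = z≤n
sumℕ-mono {suc n} f≤g = ℕP.+-mono-≤ (f≤g Fin.zero) (sumℕ-mono (f≤g ∘ Fin.suc))

sumℕ-strict : ∀ {n} {f g : Fin n → ℕ} k → (∀ i → f i ≤ g i) → f k < g k → sumℕ f < sumℕ g
sumℕ-strict Fin.zero    f≤g fk<gk = ℕP.+-mono-<-≤ fk<gk (sumℕ-mono (f≤g ∘ Fin.suc))
sumℕ-strict (Fin.suc k) f≤g fk<gk = ℕP.+-mono-≤-< (f≤g Fin.zero) (sumℕ-strict k (f≤g ∘ Fin.suc) fk<gk)

dartSumℕ : ∀ {m} → (Dart m → ℕ) → ℕ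
dartSumℕ f = sumℕ (λ e → f (e , true) + f (e , false))

dartSumℕ-strict : ∀ {m} {f g : Dart m → ℕ} y → (∀ x → f x ≤ g x) → f y < g y → dartSumℕ f < dartSumℕ g
dartSumℕ-strict {f = f} {g} (e , b) f≤g fy<gy =
  sumℕ-strict e (λ e′ → ℕP.+-mono-≤ (f≤g (e′ , true)) (f≤g (e′ , false))) (at b fy<gy)
  where
  at : ∀ b → f (e , b) < g (e , b) → f (e , true) + f (e , false) < g (e , true) + g (e , false)
  at true  lt = ℕP.+-mono-<-≤ lt (f≤g (e , false))
  at false lt = ℕP.+-mono-≤-< (f≤g (e , true)) lt

-- Shortest-path labelings by relaxation (Bellman–Ford) on the darts, for
-- a digraph with two arcs x → next i x of length cost i x out of every
-- dart, starting from an initial labeling init.  As long as some arc is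
-- tense, lower the label of its head; the total label decreases, so the
-- process stops at a feasible labeling dist ≤ init.
module Relaxation {m : ℕ} (next : Bool → Dart m → Dart m) (cost : Bool → Dart m → ℕ)
                  (init : Dart m → ℕ) where

  Labeling : Set
  Labeling = Dart m → ℕ

  Tense : Labeling → Dart m → Bool → Set
  Tense d x i = d x + cost i x < d (next i x)

  TenseArc : Labeling → Set
  TenseArc d = Σ (Dart m) λ x → Σ Bool (Tense d x)

  Feasible : Labeling → Set
  Feasible d = ∀ x i → d (next i x) ≤ d x + cost i x

  relax : (d : Labeling) → TenseArc d → Labeling
  relax d (x , i , _) y = if ⌊ y ≟D next i x ⌋ then d x + cost i x else d y

  relax-≤ : ∀ d t y → relax d t y ≤ d y
  relax-≤ d (x , i , tense) y with y ≟D next i x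
  ... | yes refl = ℕP.<⇒≤ tense
  ... | no _     = ℕP.≤-refl

  relax-head : ∀ d x i t → relax d (x , i , t) (next i x) ≡ d x + cost i x
  relax-head d x i t with next i x ≟D next i x
  ... | yes _ = refl
  ... | no ¬r = ⊥-elim (¬r refl)

  total-decreases : ∀ d t → dartSumℕ (relax d t) < dartSumℕ d
  total-decreases d t@(x , i , tense) =
    dartSumℕ-strict (next i x) (relax-≤ d t) (subst (_< d (next i x)) (sym (relax-head d x i tense)) tense)

  tenseArc? : ∀ d → Dec (TenseArc d)
  tenseArc? d = ∃Dart? (λ x → ∃Bool? (λ i → d x + cost i x <? d (next i x)))

  relaxFrom : ℕ → Labeling → Labeling
  relaxFrom zero       d = d
  relaxFrom (suc fuel) d with tenseArc? d
  ... | yes t = relaxFrom fuel (relax d t)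
  ... | no _  = d

  relaxFrom-invariant : (P : Labeling → Set) → (∀ d t → P d → P (relax d t)) →
    ∀ fuel d → dartSumℕ d < fuel → P d → P (relaxFrom fuel d) × Feasible (relaxFrom fuel d)
  relaxFrom-invariant P keep (suc fuel) d d<fuel pd with tenseArc? d
  ... | yes t = relaxFrom-invariant P keep fuel (relax d t)
                  (ℕP.<-≤-trans (total-decreases d t) (ℕP.≤-pred d<fuel)) (keep d t pd)
  ... | no relaxed = pd , λ x i → ℕP.≮⇒≥ (λ tense → relaxed (x , i , tense))

  -- dist is only used through the two facts below (kept abstract so that
  -- the relaxation loop is never unfolded)
  abstract
    dist : Labeling
    dist = relaxFrom (suc (dartSumℕ init)) init

    dist-invariant : (P : Labeling → Set) → (∀ d t → P d → P (relax d t)) → P init → P dist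
    dist-invariant P keep pinit = proj₁ (relaxFrom-invariant P keep (suc (dartSumℕ init)) init ℕP.≤-refl pinit)

    dist-feasible : Feasible dist
    dist-feasible = proj₂ (relaxFrom-invariant (λ _ → ⊤) (λ _ _ _ → tt) (suc (dartSumℕ init)) init ℕP.≤-refl tt)

  dist≤init : ∀ x → dist x ≤ init x
  dist≤init = dist-invariant (λ d → ∀ x → d x ≤ init x)
    (λ d t d≤ x → ℕP.≤-trans (relax-≤ d t x) (d≤ x)) (λ _ → ℕP.≤-refl)

  FeasiblePotential : (Dart m → ℤ) → Set
  FeasiblePotential π = ∀ x i → π (next i x) ℤ.≤ π x ℤ.+ + cost i x

  dist-maximal : ∀ π → FeasiblePotential π → (∀ x → π x ℤ.≤ + init x) → ∀ x → π x ℤ.≤ + dist x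
  dist-maximal π feasible π≤init = dist-invariant (λ d → ∀ x → π x ℤ.≤ + d x) keep π≤init
    where
    keep : ∀ d t → (∀ x → π x ℤ.≤ + d x) → ∀ y → π y ℤ.≤ + relax d t y
    keep d (x , i , tense) π≤d y with y ≟D next i x
    ... | yes refl = ℤP.≤-trans (feasible x i) (ℤP.+-monoˡ-≤ (+ cost i x) (π≤d x))
    ... | no _     = π≤d y

bit : Bool → ℕ
bit true  = 1
bit false = 0

Against : ∀ {m} → Orientation m → Dart m → Bool
Against D (e , b) = b xor D e

module Orientations {m : ℕ} (M : Map m) (D₀ : Orientation m) where

  open Faces M
  open FacePotentials M public

  record PotentialOf (D : Orientation m) (H : Dart m → ℤ) : Set where
    constructor potential
    field
      face   : FacePotential H
      flow≡δ : ∀ e → flowOf (D ∖ D₀) e ≡ δ H e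

  flow-against : ∀ D e → flowOf (D ∖ D₀) e ≡ + bit (Against D₀ (e , true)) ℤ.- + bit (Against D (e , true))
  flow-against D e with D e | D₀ e
  ... | true  | true  = refl
  ... | true  | false = refl
  ... | false | true  = refl
  ... | false | false = refl

  potential-drop : ∀ {D H} → PotentialOf D H → ∀ x →
    H x ℤ.- H (α x) ≡ + bit (Against D₀ x) ℤ.- + bit (Against D x)
  potential-drop {D} {H} (potential _ flow≡δ) (e , true) = trans (sym (flow≡δ e)) (flow-against D e)
  potential-drop {D} {H} (potential _ flow≡δ) (e , false) = begin
    H (e , false) ℤ.- H (e , true)                  ≡⟨ -‿anticomm (H (e , true)) (H (e , false)) ⟩
    ℤ.- δ H e                                       ≡⟨ cong ℤ.-_ (trans (sym (flow≡δ e)) (flow-against D e)) ⟩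
    ℤ.- (+ bit (not (D₀ e)) ℤ.- + bit (not (D e))) ≡⟨ negate-bits (D₀ e) (D e) ⟩
    + bit (D₀ e) ℤ.- + bit (D e)                    ∎
    where
    open ≡-Reasoning
    -‿anticomm : ∀ (a b : ℤ) → b ℤ.- a ≡ ℤ.- (a ℤ.- b)
    -‿anticomm = solve-∀
    negate-bits : ∀ a b → ℤ.- (+ bit (not a) ℤ.- + bit (not b)) ≡ + bit a ℤ.- + bit b
    negate-bits true  true  = refl
    negate-bits true  false = refl
    negate-bits false true  = refl
    negate-bits false false = refl

  InO⇒potential : ∀ {D} → InO M D₀ D → Σ (Dart m → ℤ) (PotentialOf D)
  InO⇒potential inO with InF⇒potential inO
  ... | H , face , flow≡δ = H , potential face flow≡δ

  potential⇒InO : ∀ {D H} → PotentialOf D H → InO M D₀ D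
  potential⇒InO {H = H} (potential face flow≡δ) = potential⇒InF H face flow≡δ

  D₀∈O : InO M D₀ D₀
  D₀∈O = potential⇒InO {D₀} {λ _ → + 0} (potential (λ _ → refl) λ e → trans (flow-against D₀ e) (ℤP.+-inverseʳ (+ bit (not (D₀ e)))))

  -- Potentials are constant on the faces of G̃: moving along a face of G
  -- keeps H, and so does crossing a rigid edge e, because D e = D₀ e
  -- (both D and D₀ lie in O(G, D₀)).
  potential-constant-step : ∀ {D H} → InO M D₀ D → PotentialOf D H → ∀ {x y} → Step M D₀ x y → H x ≡ H y
  potential-constant-step inO pot (inj₁ refl) = PotentialOf.face pot (reach-step _)
  potential-constant-step {D} {H} inO pot {e , b} (inj₂ (rigid , refl)) = ℤP.i-j≡0⇒i≡j _ _ (begin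
    H (e , b) ℤ.- H (e , not b)                  ≡⟨ potential-drop pot (e , b) ⟩
    + bit (b xor D₀ e) ℤ.- + bit (b xor D e)     ≡⟨ cong (λ c → + bit (b xor D₀ e) ℤ.- + bit (b xor c)) (rigid D D₀ inO D₀∈O) ⟩
    + bit (b xor D₀ e) ℤ.- + bit (b xor D₀ e)    ≡⟨ ℤP.+-inverseʳ (+ bit (b xor D₀ e)) ⟩
    + 0                                          ∎)
    where open ≡-Reasoning

  potential-constant-G̃ : ∀ {D H} → InO M D₀ D → PotentialOf D H →
    ∀ {x y} → SameFaceG̃ M D₀ x y → H x ≡ H y
  potential-constant-G̃ inO pot ε              = refl
  potential-constant-G̃ inO pot (fwd s ◅ path) =
    trans (potential-constant-step inO pot s) (potential-constant-G̃ inO pot path)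
  potential-constant-G̃ inO pot (bwd s ◅ path) =
    trans (sym (potential-constant-step inO pot s)) (potential-constant-G̃ inO pot path)

against-true : ∀ {b c} → c ≢ b → b xor c ≡ true
against-true {true}  {true}  c≢b = ⊥-elim (c≢b refl)
against-true {true}  {false} _   = refl
against-true {false} {true}  _   = refl
against-true {false} {false} c≢b = ⊥-elim (c≢b refl)

xor-cancelˡ : ∀ b {c c′} → b xor c ≡ b xor c′ → c ≡ c′
xor-cancelˡ true  eq = BoolP.not-injective eq
xor-cancelˡ false eq = eq

pathLength : ∀ {A : Set} {R : A → A → Set} {x y} → Star R x y → ℕ
pathLength ε       = 0
pathLength (_ ◅ p) = suc (pathLength p)

module Extremal {m : ℕ} (M : Map m) (D₀ : Orientation m) (d₀ : Dart m) where

  open Faces M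
  open Orientations M D₀

  next : Bool → Dart m → Dart m
  next true  = φ M
  next false = α

  cost : Bool → Dart m → ℕ
  cost true  x = 0
  cost false x = bit (Against D₀ x)

  init : Dart m → ℕ
  init y = if ⌊ y ≟D d₀ ⌋ then 0 else pathLength (connected M d₀ y)

  open Relaxation next cost init

  ConnectStep : Dart m → Dart m → Set
  ConnectStep x y = (rot M x ≡ y) ⊎ (α x ≡ y)

  -- A feasible potential grows by at most 1 along each step of a
  -- connecting path, since rot x = φ (α x) and all lengths are ≤ 1.
  feasible-path-bound : ∀ π → FeasiblePotential π → ∀ {x y} (p : Star ConnectStep x y) →
    π y ℤ.≤ π x ℤ.+ + pathLength p
  feasible-path-bound π feasible ε = ℤP.≤-reflexive (sym (ℤP.+-identityʳ (π _)))
  feasible-path-bound π feasible {x} (s ◅ p) = ℤP.≤-trans (feasible-path-bound π feasible p)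
    (ℤP.≤-trans (ℤP.+-monoˡ-≤ (+ pathLength p) (one-step s)) (ℤP.≤-reflexive (ℤP.+-assoc (π x) (+ 1) _)))
    where
    cost≤1 : ∀ x → π (α x) ℤ.≤ π x ℤ.+ + 1
    cost≤1 x = ℤP.≤-trans (feasible x false) (ℤP.+-monoʳ-≤ (π x) (ℤ.+≤+ (bit≤1 (Against D₀ x))))
      where
      bit≤1 : ∀ b → bit b ≤ 1
      bit≤1 true  = ℕP.≤-refl
      bit≤1 false = z≤n
    one-step : ∀ {x y} → ConnectStep x y → π y ℤ.≤ π x ℤ.+ + 1
    one-step {x} (inj₁ refl) = ℤP.≤-trans (ℤP.≤-reflexive (cong (λ z → π (rot M z)) (sym (α-involutive x))))
      (ℤP.≤-trans (ℤP.≤-trans (feasible (α x) true) (ℤP.≤-reflexive (ℤP.+-identityʳ _))) (cost≤1 x))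
    one-step (inj₂ refl) = cost≤1 _

  relative : (Dart m → ℤ) → Dart m → ℤ
  relative H y = H d₀ ℤ.- H y

  relative-feasible : ∀ {D H} → PotentialOf D H → FeasiblePotential (relative H)
  relative-feasible {H = H} pot x true = ℤP.≤-reflexive (begin
    H d₀ ℤ.- H (φ M x)        ≡⟨ cong (λ z → H d₀ ℤ.- z) (sym (PotentialOf.face pot (reach-step x))) ⟩
    H d₀ ℤ.- H x              ≡⟨ sym (ℤP.+-identityʳ _) ⟩
    (H d₀ ℤ.- H x) ℤ.+ + 0    ∎)
    where open ≡-Reasoning
  relative-feasible {D} {H} pot x false = begin
    H d₀ ℤ.- H (α x)                                                  ≡⟨ split (H d₀) (H x) (H (α x)) ⟩
    (H d₀ ℤ.- H x) ℤ.+ (H x ℤ.- H (α x))                              ≡⟨ cong (λ z → (H d₀ ℤ.- H x) ℤ.+ z) (potential-drop pot x) ⟩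
    (H d₀ ℤ.- H x) ℤ.+ (+ bit (Against D₀ x) ℤ.- + bit (Against D x)) ≤⟨ ℤP.+-monoʳ-≤ (H d₀ ℤ.- H x) (ℤP.i-j≤i _ (+ bit (Against D x))) ⟩
    (H d₀ ℤ.- H x) ℤ.+ + bit (Against D₀ x)                           ∎
    where
    open ℤP.≤-Reasoning
    split : ∀ (a b c : ℤ) → a ℤ.- c ≡ (a ℤ.- b) ℤ.+ (b ℤ.- c)
    split = solve-∀

  relative≤init : ∀ {D H} → PotentialOf D H → ∀ y → relative H y ℤ.≤ + init y
  relative≤init {H = H} pot y with y ≟D d₀
  ... | yes refl = ℤP.≤-reflexive (ℤP.+-inverseʳ (H d₀))
  ... | no _ = ℤP.≤-trans (feasible-path-bound (relative H) (relative-feasible pot) (connected M d₀ y))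
    (ℤP.≤-reflexive (trans (cong (λ z → z ℤ.+ + pathLength (connected M d₀ y)) (ℤP.+-inverseʳ (H d₀))) (ℤP.+-identityˡ _)))

  relative≤dist : ∀ {D H} → PotentialOf D H → ∀ y → relative H y ℤ.≤ + dist y
  relative≤dist pot = dist-maximal _ (relative-feasible pot) (relative≤init pot)

  dist-d₀ : dist d₀ ≡ 0
  dist-d₀ = ℕP.n≤0⇒n≡0 (subst (dist d₀ ≤_) init-d₀ (dist≤init d₀))
    where
    init-d₀ : init d₀ ≡ 0
    init-d₀ with d₀ ≟D d₀
    ... | yes _  = refl
    ... | no ¬eq = ⊥-elim (¬eq refl)

  D* : Orientation m
  D* e = if ⌊ dist (e , true) ℕ.≟ dist (e , false) ⌋ then D₀ e else not (D₀ e)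

  H* : Dart m → ℤ
  H* x = ℤ.- (+ dist x)

  -- Feasibility says the distances a, c of the two darts of e differ by at
  -- most the lengths of the α-arcs; the choice of D* then makes the flow of
  -- D* ∖ D₀ on e equal to c − a.
  choice-flow : ∀ b a c → c ≤ a + bit (not b) → a ≤ c + bit b →
    + bit (not b) ℤ.- + bit (not (if ⌊ a ℕ.≟ c ⌋ then b else not b)) ≡ + c ℤ.- + a
  choice-flow b a c c≤ a≤ with a ℕ.≟ c
  choice-flow b     a .a c≤ a≤ | yes refl = trans (ℤP.+-inverseʳ (+ bit (not b))) (sym (ℤP.+-inverseʳ (+ a)))
  choice-flow true  a c  c≤ a≤ | no a≢c
    rewrite ℕP.≤-antisym (subst (a ≤_) (ℕP.+-comm c 1) a≤) (ℕP.≤∧≢⇒< (subst (c ≤_) (ℕP.+-identityʳ a) c≤) (a≢c ∘ sym))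
    = down (+ c)
    where
    down : ∀ (z : ℤ) → + 0 ℤ.- + 1 ≡ z ℤ.- (+ 1 ℤ.+ z)
    down = solve-∀
  choice-flow false a c  c≤ a≤ | no a≢c
    rewrite ℕP.≤-antisym (subst (c ≤_) (ℕP.+-comm a 1) c≤) (ℕP.≤∧≢⇒< (subst (a ≤_) (ℕP.+-identityʳ c) a≤) a≢c)
    = up (+ a)
    where
    up : ∀ (z : ℤ) → + 1 ℤ.- + 0 ≡ (+ 1 ℤ.+ z) ℤ.- z
    up = solve-∀

  H*-potential : PotentialOf D* H*
  H*-potential = potential
    (λ r → cong (λ n → ℤ.- (+ n)) (non-increasing⇒constant dist (λ x → subst (dist (φ M x) ≤_) (ℕP.+-identityʳ _) (dist-feasible x true)) r))
    (λ e → trans (flow-against D* e) (trans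
      (choice-flow (D₀ e) (dist (e , true)) (dist (e , false)) (dist-feasible (e , true) false) (dist-feasible (e , false) false))
      (negate-difference (+ dist (e , true)) (+ dist (e , false)))))
    where
    negate-difference : ∀ (a c : ℤ) → c ℤ.- a ≡ ℤ.- a ℤ.- ℤ.- c
    negate-difference = solve-∀

  D*∈O : InO M D₀ D*
  D*∈O = potential⇒InO H*-potential

  -- Arithmetic core of the key lemma: a distance n = [a₀] − 1 forces a₀,
  -- and then a relative potential z = [a₀] − [a] ≤ n forces a.
  against-forced : ∀ a₀ a {n z} → + n ≡ + bit a₀ ℤ.- + 1 → z ≡ + bit a₀ ℤ.- + bit a → z ℤ.≤ + n → a ≡ true
  against-forced false _     ()   _    _
  against-forced true  true  _    _    _             = refl
  against-forced true  false refl refl (ℤ.+≤+ ())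

  -- Potentials are constant on faces of
  -- G̃, so x = (e , b) is at distance 0 like d₀ and the reverse dart α x is
  -- at distance [x against D₀] − 1.  For D ∈ O(G, D₀) the relative
  -- potential of α x is [x against D₀] − [x against D] and is at most that
  -- distance, so x runs against D as it does against D*: D e = D* e.
  disagreement⇒rigid : ∀ {e b} → SameFaceG̃ M D₀ d₀ (e , b) → D* e ≢ b → Rigid M D₀ e
  disagreement⇒rigid {e} {b} same D*e≢b D D′ inO inO′ = trans (agrees D inO) (sym (agrees D′ inO′))
    where
    x : Dart m
    x = e , b

    H*x≡0 : H* x ≡ + 0
    H*x≡0 = trans (sym (potential-constant-G̃ D*∈O H*-potential same)) (cong (λ n → ℤ.- (+ n)) dist-d₀)

    dist-reverse : + dist (α x) ≡ + bit (Against D₀ x) ℤ.- + 1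
    dist-reverse = begin
      + dist (α x)                                    ≡⟨ sym (ℤP.neg-involutive (+ dist (α x))) ⟩
      ℤ.- H* (α x)                                    ≡⟨ sym (ℤP.+-identityˡ _) ⟩
      + 0 ℤ.- H* (α x)                                ≡⟨ cong (λ z → z ℤ.- H* (α x)) (sym H*x≡0) ⟩
      H* x ℤ.- H* (α x)                               ≡⟨ potential-drop H*-potential x ⟩
      + bit (Against D₀ x) ℤ.- + bit (Against D* x)   ≡⟨ cong (λ a → + bit (Against D₀ x) ℤ.- + bit a) (against-true D*e≢b) ⟩
      + bit (Against D₀ x) ℤ.- + 1                    ∎
      where open ≡-Reasoning

    agrees : ∀ D → InO M D₀ D → D e ≡ D* e
    agrees D inO with InO⇒potential {D} inO
    ... | H , pot = xor-cancelˡ b (trans (against-forced (Against D₀ x) (Against D x) dist-reverse relative-reverse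
                                           (relative≤dist pot (α x)))
                                         (sym (against-true D*e≢b)))
      where
      relative-reverse : relative H (α x) ≡ + bit (Against D₀ x) ℤ.- + bit (Against D x)
      relative-reverse = trans (cong (λ z → z ℤ.- H (α x)) (potential-constant-G̃ {D} inO pot same)) (potential-drop pot x)

proposition37 : ∀ {m : ℕ} (M : Map m) (D₀ : Orientation m) (f₀ : Dart m)
    (F : OrSub m) → InFtilde M D₀ F →
    Σ[ D ∈ Orientation m ] (InO M D₀ D × SubOf F D)
proposition37 M D₀ _ F (d₀ , F-spec) = D* , D*∈O , F⊆D*
  where
  open Extremal M D₀ d₀

  F⊆D* : SubOf F D*
  F⊆D* e b Fe≡b with proj₁ (F-spec e b) Fe≡b
  ... | non-rigid , same , _ with D* e BoolP.≟ b
  ...   | yes D*e≡b = D*e≡b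
  ...   | no  D*e≢b = ⊥-elim (non-rigid (disagreement⇒rigid same D*e≢b))
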